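{- Let $G$ be a connected graph. Then: (1) $b_{\rm g}(G)=1$ if and only if $G=K_1$; (2) $b_{\rm g}'(G)=1$ if and only if $G=K_1$; (3) $b_{\rm g}(G)=2$ if and only if $G\neq K_1$ and $\Delta(G) \ge |V(G)|-2$; (4) $b_{\rm g}'(G)=2$ if and only if $G \ne K_1$ and $\delta(G) \ge |V(G)|-2$ (equivalently, $G$ is isomorphic to a complete graph on at least two vertices with the edges of a possibly empty matching removed).
   Context: $\Delta(G)$ and $\delta(G)$ denote the maximum and minimum degree. The burning game on a finite simple graph $G$ is played by two players, Burner and Staller. Each vertex is either burned or unburned, and once burned it stays burned. In round 1 the starting player chooses one unburned vertex and burns it (selection phase only). Each round $t \ge 2$ consists of a spreading phase, in which every unburned vertex with a burned neighbor becomes burned, followed, if unburned vertices remain, by a selection phase in which the player whose turn it is burns one unburned vertex; the two players make the selections alternately. The game ends in the first round in which all vertices are burned (this may happen right after a spreading phase), and its length is the number of that round. Burner wants to minimize the length and Staller to maximize it. $b_{\rm g}(G)$ is the length under optimal play when Burner makes the first selection, and $b_{\rm g}'(G)$ is the length under optimal play when Staller makes the first selection. -}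

module Defs where

open import Data.Nat using (ℕ; zero; suc; _∸_; _⊔_; _⊓_)
open import Data.Bool using (Bool; true; false; if_then_else_; _∨_; _∧_; not; T)
open import Data.Fin using (Fin)
open import Data.Fin.Properties using (_≟_)
open import Data.List using (List; []; _∷_; map; foldr; filterᵇ; allFin)
open import Data.Bool.ListAction using (all; any)
open import Data.Nat.ListAction using (sum)
open import Relation.Nullary.Decidable using (⌊_⌋)
open import Relation.Binary.PropositionalEquality using (_≡_)

record Graph (n : ℕ) : Set where
  field
    adj   : Fin n → Fin n → Bool
    sym   : ∀ u v → adj u v ≡ adj v u
    irrefl : ∀ v → adj v v ≡ false
open Graph public

module _ {n : ℕ} (G : Graph n) where

  data Reach (u : Fin n) : Fin n → Set where
    here : Reach u u
    step : ∀ {v w} → Reach u v → T (adj G v w) → Reach u w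

  Connected : Set
  Connected = Fin n × ((u v : Fin n) → Reach u v)
    where open import Data.Product using (_×_)

  degree : Fin n → ℕ
  degree v = sum (map (λ u → if adj G v u then 1 else 0) (allFin n))

  -- maximum degree Δ(G) (0 for the empty graph)
  maxDegree : ℕ
  maxDegree = foldr _⊔_ 0 (map degree (allFin n))

  -- minimum degree δ(G); every degree is < n, so seeding with n is harmless
  -- for n ≥ 1
  minDegree : ℕ
  minDegree = foldr _⊓_ n (map degree (allFin n))

data Player : Set where
  Burner Staller : Player

other : Player → Player
other Burner = Staller
other Staller = Burner

-- optimal choice of the player among the values of the available moves
-- (the list is nonempty whenever it is used)
opt : Player → List ℕ → ℕ
opt p [] = 0
opt Burner  (x ∷ xs) = foldr _⊓_ x xs
opt Staller (x ∷ xs) = foldr _⊔_ x xs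

module _ {n : ℕ} (G : Graph n) where

  Burned : Set
  Burned = Fin n → Bool

  full : Burned → Bool
  full S = all S (allFin n)

  spread : Burned → Burned
  spread S v = S v ∨ any (λ u → S u ∧ adj G u v) (allFin n)

  burn : Fin n → Burned → Burned
  burn v S w = ⌊ v ≟ w ⌋ ∨ S w

  unburned : Burned → List (Fin n)
  unburned S = filterᵇ (λ v → not (S v)) (allFin n)

  -- rest fuel S p : number of further rounds under optimal play, when the
  -- current round has just finished with burned set S and p is the player
  -- making the next selection.  Every round burns at least one new vertex,
  -- so fuel = n is sufficient for all positions reached from round 1.
  rest : ℕ → Burned → Player → ℕ
  rest zero S p = 0
  rest (suc f) S p =
    if full S then 0
    else (if full (spread S) then 1
          else suc (opt p (map (λ v → rest f (burn v (spread S)) (other p))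
                               (unburned (spread S)))))

  noneBurned : Burned
  noneBurned _ = false

  -- length of the game under optimal play when player p makes the first
  -- selection (round 1: selection only)
  gameLength : Player → ℕ
  gameLength p =
    suc (opt p (map (λ v → rest n (burn v noneBurned) (other p)) (allFin n)))

  bg : ℕ
  bg = gameLength Burner

  bg' : ℕ
  bg' = gameLength Staller

module Submission where

-- After the first selection of a vertex v (n ≥ 2) the game is not over, and the spreading
-- phase of round 2 burns exactly the closed neighbourhood N[v].  The game then ends in
-- round 2 iff at most one vertex lies outside N[v] (that vertex is the next selection),
-- whoever selects next; this is deg v ≥ n − 2.  So b_g = 2 iff some vertex satisfies it
-- (Burner chooses v) and b_g' = 2 iff every vertex does (Staller chooses v), while on
-- K_1 the first selection already ends the game.

open import Defs hiding (sym)
open import Data.Nat using (ℕ; zero; suc; _≤_; _∸_; _+_; _⊔_; _⊓_; z≤n; s≤s)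
open import Data.Nat.Properties
  using ( ≤-refl; ≤-reflexive; ≤-trans; ≤-antisym; ≤-pred; ≰⇒>; suc-injective; +-comm; +-suc
        ; +-monoʳ-≤; m≤n+m; m+1+n≰m; m≤n+o⇒m∸n≤o; ⊓-sel; ⊔-sel; ⊓-glb; ⊔-lub; m⊓n≤m; m⊓n≤n
        ; m≤m⊔n; m≤n⊔m; m≤n⇒m⊓o≤n; m≤n⇒o⊓m≤n; m≤n⇒m≤n⊔o; m≤n⇒m≤o⊔n )
open import Data.Bool using (Bool; true; false; T; not; if_then_else_)
open import Data.Bool.Properties using (T-≡; T-∨; T-∧; ⇔→≡)
open import Data.Empty using (⊥-elim)
open import Data.Fin using (Fin; zero; suc)
open import Data.Fin.Properties using (¬∀⟶∃¬)
import Data.Fin.Properties as Fin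
open import Data.Product as Product using (_×_; _,_; proj₂; ∃-syntax)
open import Data.Sum as Sum using (_⊎_; inj₁; inj₂; [_,_]′)
open import Data.List using (List; []; _∷_; map; foldr; allFin; tabulate)
open import Data.Nat.ListAction using (sum)
open import Data.List.Properties using (foldr-preservesᵒ; foldr-preservesᵇ; foldr-preservesʳ; foldr-forcesᵇ)
open import Data.List.Relation.Unary.All as All using (All; _∷_)
open import Data.List.Relation.Unary.Any as Any using (Any; here; there)
import Data.List.Relation.Unary.All.Properties as All
import Data.List.Relation.Unary.Any.Properties as Any
open import Data.List.Membership.Propositional using (_∈_; find; lose)
open import Data.List.Membership.Propositional.Properties using (foldr-selective; ∈-allFin; ∈-filter⁺; ∈-filter⁻; ∈-map⁺)
open import Relation.Nullary using (¬_; yes; no)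
open import Relation.Nullary.Decidable using (T?; toWitness; fromWitness)
open import Relation.Binary.PropositionalEquality using (_≡_; _≢_; refl; sym; trans; subst; cong; cong₂; module ≡-Reasoning)
open import Function using (_∘_; id; const)
open import Function.Bundles using (_⇔_; mk⇔; Equivalence)
import Function.Properties.Equivalence as ⇔
import Relation.Binary.Reasoning.Setoid
open import Level using (0ℓ)

open Equivalence using (to; from)

module ⇔-Reasoning = Relation.Binary.Reasoning.Setoid (⇔.⇔-setoid 0ℓ)

AtMostOne : {A : Set} → (A → Set) → Set
AtMostOne P = ∀ x y → P x → P y → x ≡ y

T-not : ∀ {b} → T (not b) ⇔ (¬ T b)
T-not {true} = mk⇔ (λ ()) (λ ¬t → ¬t _)
T-not {false} = mk⇔ (λ _ ()) (const _)

T-injective : ∀ {a b} → (T a ⇔ T b) → a ≡ b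
T-injective a⇔b = ⇔→≡ (⇔.trans (⇔.sym T-≡) (⇔.trans a⇔b T-≡))

foldr-⊓-≤⇔ : ∀ e xs {k} → foldr _⊓_ e xs ≤ k ⇔ (e ≤ k ⊎ Any (_≤ k) xs)
foldr-⊓-≤⇔ e xs {k} = mk⇔
  (λ h → Sum.map (λ eq → subst (_≤ k) eq h) (Any.map (λ eq → subst (_≤ k) eq h))
                 (foldr-selective ⊓-sel e xs))
  (foldr-preservesᵒ (λ x y → [ m≤n⇒m⊓o≤n y , m≤n⇒o⊓m≤n x ]′) e xs)

≤-foldr-⊔⇔ : ∀ e xs {k} → k ≤ foldr _⊔_ e xs ⇔ (k ≤ e ⊎ Any (k ≤_) xs)
≤-foldr-⊔⇔ e xs {k} = mk⇔
  (λ h → Sum.map (λ eq → subst (k ≤_) eq h) (Any.map (λ eq → subst (k ≤_) eq h))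
                 (foldr-selective ⊔-sel e xs))
  (foldr-preservesᵒ (λ x y → [ m≤n⇒m≤n⊔o y , m≤n⇒m≤o⊔n x ]′) e xs)

foldr-⊔-≤⇔ : ∀ e xs {k} → foldr _⊔_ e xs ≤ k ⇔ (e ≤ k × All (_≤ k) xs)
foldr-⊔-≤⇔ e xs {k} = mk⇔
  (λ h → ≤-trans (foldr-preservesʳ {P = e ≤_} (λ x → m≤n⇒m≤o⊔n x) ≤-refl xs) h
       , foldr-forcesᵇ {P = _≤ k} (λ x y h → ≤-trans (m≤m⊔n x y) h , ≤-trans (m≤n⊔m x y) h) e xs h)
  (λ (e≤k , xs≤k) → foldr-preservesᵇ ⊔-lub e≤k xs≤k)

≤-foldr-⊓⇔ : ∀ e xs {k} → k ≤ foldr _⊓_ e xs ⇔ (k ≤ e × All (k ≤_) xs)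
≤-foldr-⊓⇔ e xs {k} = mk⇔
  (λ h → ≤-trans h (foldr-preservesʳ {P = _≤ e} (λ x → m≤n⇒o⊓m≤n x) ≤-refl xs)
       , foldr-forcesᵇ {P = k ≤_} (λ x y h → ≤-trans h (m⊓n≤m x y) , ≤-trans h (m⊓n≤n x y)) e xs h)
  (λ (k≤e , k≤xs) → foldr-preservesᵇ ⊓-glb k≤e k≤xs)

opt-Burner-≤⇔ : ∀ xs {k} → opt Burner xs ≤ k ⇔ (xs ≡ [] ⊎ Any (_≤ k) xs)
opt-Burner-≤⇔ [] = mk⇔ (const (inj₁ refl)) (const z≤n)
opt-Burner-≤⇔ (x ∷ xs) = mk⇔
  (inj₂ ∘ [ here , there ]′ ∘ to (foldr-⊓-≤⇔ x xs))
  (λ { (inj₁ ()) ; (inj₂ (here x≤k)) → from (foldr-⊓-≤⇔ x xs) (inj₁ x≤k)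
                 ; (inj₂ (there xs≤k)) → from (foldr-⊓-≤⇔ x xs) (inj₂ xs≤k) })

opt-Staller-≤⇔ : ∀ xs {k} → opt Staller xs ≤ k ⇔ All (_≤ k) xs
opt-Staller-≤⇔ [] = mk⇔ (const All.[]) (const z≤n)
opt-Staller-≤⇔ (x ∷ xs) = mk⇔
  ((λ (x≤k , xs≤k) → x≤k ∷ xs≤k) ∘ to (foldr-⊔-≤⇔ x xs))
  (λ { (x≤k ∷ xs≤k) → from (foldr-⊔-≤⇔ x xs) (x≤k , xs≤k) })

m+1+n∸2≤m⇔n≤1 : ∀ m n → m + suc n ∸ 2 ≤ m ⇔ n ≤ 1
m+1+n∸2≤m⇔n≤1 m n = mk⇔ (to′ n)
  (λ n≤1 → m≤n+o⇒m∸n≤o (m + suc n) 2 (≤-trans (+-monoʳ-≤ m (s≤s n≤1)) (≤-reflexive (+-comm m 2))))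
  where
  to′ : ∀ n → m + suc n ∸ 2 ≤ m → n ≤ 1
  to′ zero _ = z≤n
  to′ (suc zero) _ = s≤s z≤n
  to′ (suc (suc n)) h rewrite +-suc m (suc (suc n)) | +-suc m (suc n) = ⊥-elim (m+1+n≰m m h)

Any-map-allFin⇔ : ∀ {n} {A : Set} {P : A → Set} (f : Fin n → A) →
  Any P (map f (allFin n)) ⇔ (∃[ v ] P (f v))
Any-map-allFin⇔ f = mk⇔ (λ p → let v , _ , pv = find (Any.map⁻ p) in v , pv)
                        (λ (v , pv) → Any.map⁺ (lose (∈-allFin v) pv))

All-map-allFin⇔ : ∀ {n} {A : Set} {P : A → Set} (f : Fin n → A) →
  All P (map f (allFin n)) ⇔ (∀ v → P (f v))
All-map-allFin⇔ f = mk⇔ (λ ps v → All.lookup (All.map⁻ ps) (∈-allFin v))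
                        (λ h → All.map⁺ (All.tabulate λ {v} _ → h v))

indicator : Bool → ℕ
indicator b = if b then 1 else 0

count : ∀ {n} → (Fin n → Bool) → ℕ
count {zero} f = 0
count {suc n} f = indicator (f zero) + count (f ∘ suc)

sum-indicator-tabulate : ∀ {A : Set} {n} (p : A → Bool) (g : Fin n → A) →
  sum (map (indicator ∘ p) (tabulate g)) ≡ count (p ∘ g)
sum-indicator-tabulate {n = zero} p g = refl
sum-indicator-tabulate {n = suc n} p g =
  cong (indicator (p (g zero)) +_) (sum-indicator-tabulate p (g ∘ suc))

count-cong : ∀ {n} {f g : Fin n → Bool} → (∀ u → f u ≡ g u) → count f ≡ count g
count-cong {zero} _ = refl
count-cong {suc n} f≗g = cong₂ _+_ (cong indicator (f≗g zero)) (count-cong (f≗g ∘ suc))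

count-+-count-not : ∀ {n} (f : Fin n → Bool) → count f + count (not ∘ f) ≡ n
count-+-count-not {zero} f = refl
count-+-count-not {suc n} f with f zero
... | true = cong suc (count-+-count-not (f ∘ suc))
... | false = trans (+-suc (count (f ∘ suc)) _) (cong suc (count-+-count-not (f ∘ suc)))

count-remove : ∀ {n} {f g : Fin n → Bool} v → f v ≡ true → g v ≡ false →
  (∀ u → u ≢ v → g u ≡ f u) → count f ≡ suc (count g)
count-remove {f = f} {g} zero fv gv g≗f = begin
  indicator (f zero) + count (f ∘ suc)  ≡⟨ cong (λ b → indicator b + count (f ∘ suc)) fv ⟩
  suc (count (f ∘ suc))                 ≡⟨ cong suc (count-cong (λ u → sym (g≗f (suc u) λ ()))) ⟩
  suc (count (g ∘ suc))                 ≡⟨ cong (λ b → suc (indicator b + count (g ∘ suc))) gv ⟨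
  suc (count g)                         ∎
  where open ≡-Reasoning
count-remove {f = f} {g} (suc v) fv gv g≗f = begin
  indicator (f zero) + count (f ∘ suc)      ≡⟨ cong₂ _+_ (cong indicator (sym (g≗f zero λ ())))
                                                  (count-remove v fv gv λ u u≢v → g≗f (suc u) (u≢v ∘ Fin.suc-injective)) ⟩
  indicator (g zero) + suc (count (g ∘ suc)) ≡⟨ +-suc (indicator (g zero)) _ ⟩
  suc (count g)                              ∎
  where open ≡-Reasoning

count≤0⇔ : ∀ {n} {f : Fin n → Bool} → count f ≤ 0 ⇔ (∀ u → ¬ T (f u))
count≤0⇔ {zero} = mk⇔ (λ _ ()) (const z≤n)
count≤0⇔ {suc n} {f} with f zero in f₀
... | true = mk⇔ (λ ()) (λ none → ⊥-elim (none zero (from T-≡ f₀)))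
... | false = mk⇔ (λ h → λ { zero t → subst T f₀ t ; (suc u) → to count≤0⇔ h u })
                  (λ none → from count≤0⇔ (none ∘ suc))

count≤1⇔ : ∀ {n} {f : Fin n → Bool} → count f ≤ 1 ⇔ AtMostOne (T ∘ f)
count≤1⇔ {zero} = mk⇔ (λ _ ()) (const z≤n)
count≤1⇔ {suc n} {f} with f zero in f₀
... | true = mk⇔ (λ h x y tx ty → trans (onlyZero (≤-pred h) x tx) (sym (onlyZero (≤-pred h) y ty)))
                 (λ amo → s≤s (from count≤0⇔ λ u t → Fin.0≢1+n (sym (amo (suc u) zero t (from T-≡ f₀)))))
  where
  onlyZero : count (f ∘ suc) ≤ 0 → ∀ u → T (f u) → u ≡ zero
  onlyZero _ zero _ = refl
  onlyZero h (suc u) t = ⊥-elim (to count≤0⇔ h u t)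
... | false = mk⇔ (amoSuc ∘ to count≤1⇔)
                  (λ amo → from count≤1⇔ λ x y tx ty → Fin.suc-injective (amo (suc x) (suc y) tx ty))
  where
  amoSuc : AtMostOne (T ∘ f ∘ suc) → AtMostOne (T ∘ f)
  amoSuc amo zero _ t _ = ⊥-elim (subst T f₀ t)
  amoSuc amo (suc _) zero _ t = ⊥-elim (subst T f₀ t)
  amoSuc amo (suc x) (suc y) tx ty = cong suc (amo x y tx ty)

module _ {n : ℕ} (G : Graph n) where

  T-full : ∀ {S} → T (full G S) ⇔ (∀ u → T (S u))
  T-full {S} = mk⇔ (λ t u → All.lookup (All.all⁺ S (allFin n) t) (∈-allFin u))
                   (λ h → All.all⁻ S {xs = allFin n} (All.tabulate λ {u} _ → h u))

  T-burn : ∀ {v S u} → T (burn G v S u) ⇔ (v ≡ u ⊎ T (S u))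
  T-burn = mk⇔ (Sum.map₁ toWitness ∘ to T-∨) (from T-∨ ∘ Sum.map₁ fromWitness)

  T-spread : ∀ {S u} → T (spread G S u) ⇔ (T (S u) ⊎ (∃[ w ] (T (S w) × T (adj G w u))))
  T-spread = mk⇔
    (Sum.map₂ (λ t → let w , _ , t′ = find (Any.any⁻ _ (allFin n) t) in w , to T-∧ t′) ∘ to T-∨)
    (from T-∨ ∘ Sum.map₂ λ (w , sw , a) → Any.any⁺ _ (lose (∈-allFin w) (from T-∧ (sw , a))))

  ∈-unburned⇔ : ∀ {S u} → u ∈ unburned G S ⇔ (¬ T (S u))
  ∈-unburned⇔ {S} = mk⇔ (to T-not ∘ proj₂ ∘ ∈-filter⁻ (T? ∘ not ∘ S) {xs = allFin n})
                        (∈-filter⁺ (T? ∘ not ∘ S) (∈-allFin _) ∘ from T-not)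

  All-unburned⇔ : ∀ {P : Fin n → Set} {S} → All P (unburned G S) ⇔ (∀ u → ¬ T (S u) → P u)
  All-unburned⇔ = mk⇔ (λ ps u ¬s → All.lookup ps (from ∈-unburned⇔ ¬s))
                      (λ h → All.tabulate λ u∈ → h _ (to ∈-unburned⇔ u∈))

  Any-unburned⇔ : ∀ {P : Fin n → Set} {S} → Any P (unburned G S) ⇔ (∃[ u ] (¬ T (S u) × P u))
  Any-unburned⇔ = mk⇔ (λ p → let u , u∈ , pu = find p in u , to ∈-unburned⇔ u∈ , pu)
                      (λ (u , ¬s , pu) → lose (from ∈-unburned⇔ ¬s) pu)

  full-burn⇔ : ∀ {w S} → T (full G (burn G w S)) ⇔ (∀ u → ¬ T (S u) → w ≡ u)
  full-burn⇔ {w} {S} = mk⇔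
    (λ t u ¬s → [ id , ⊥-elim ∘ ¬s ]′ (to (T-burn {S = S}) (to T-full t u)))
    (λ h → from T-full λ u → from (T-burn {S = S}) (covered h u))
    where
    covered : (∀ u → ¬ T (S u) → w ≡ u) → ∀ u → w ≡ u ⊎ T (S u)
    covered h u with T? (S u)
    ... | yes s = inj₂ s
    ... | no ¬s = inj₁ (h u ¬s)

  rest≤0⇔ : ∀ f p S → rest G (suc f) S p ≤ 0 ⇔ T (full G S)
  rest≤0⇔ f p S with full G S
  ... | true = mk⇔ (const _) (const z≤n)
  ... | false with full G (spread G S)
  ...   | true = mk⇔ (λ ()) (λ ())
  ...   | false = mk⇔ (λ ()) (λ ())

  rest-burn≤0⇔ : ∀ f p w S → rest G (suc f) (burn G w S) p ≤ 0 ⇔ (∀ u → ¬ T (S u) → w ≡ u)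
  rest-burn≤0⇔ f p w S = ⇔.trans (rest≤0⇔ f p (burn G w S)) full-burn⇔

  lastSelection≤0⇔ : ∀ f p S → ¬ T (full G S) →
    opt p (map (λ w → rest G (suc f) (burn G w S) (other p)) (unburned G S)) ≤ 0
      ⇔ AtMostOne (λ u → ¬ T (S u))
  lastSelection≤0⇔ f Staller S _ = mk⇔
    (λ h x y ¬x ¬y →
      to (rest-burn≤0⇔ f Burner x S) (to All-unburned⇔ (All.map⁻ (to (opt-Staller-≤⇔ _) h)) x ¬x) y ¬y)
    (λ amo → from (opt-Staller-≤⇔ _) (All.map⁺ (from All-unburned⇔ λ w ¬w →
               from (rest-burn≤0⇔ f Burner w S) λ u ¬u → amo w u ¬w ¬u)))
  lastSelection≤0⇔ f Burner S ¬full = mk⇔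
    (λ h x y ¬x ¬y → [ (λ L≡[] → ⊥-elim (nonempty ¬x L≡[]))
                     , (λ c → let w , _ , c = to Any-unburned⇔ (Any.map⁻ c)
                                  finishes = to (rest-burn≤0⇔ f Staller w S) c
                              in trans (sym (finishes x ¬x)) (finishes y ¬y)) ]′
                     (to (opt-Burner-≤⇔ _) h))
    (λ amo → let w , ¬w = ¬∀⟶∃¬ n (T ∘ S) (T? ∘ S) (¬full ∘ from T-full)
             in from (opt-Burner-≤⇔ _) (inj₂ (Any.map⁺ (from Any-unburned⇔
                  (w , ¬w , from (rest-burn≤0⇔ f Staller w S) λ u ¬u → amo w u ¬w ¬u)))))
    where
    nonempty : ∀ {x} → ¬ T (S x) →
      map (λ w → rest G (suc f) (burn G w S) Staller) (unburned G S) ≢ []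
    nonempty {x} ¬x L≡[]
      with () ← subst (rest G (suc f) (burn G x S) Staller ∈_) L≡[] (∈-map⁺ _ (from ∈-unburned⇔ ¬x))

  rest≤1⇔ : ∀ f p S → ¬ T (full G S) →
    rest G (suc (suc f)) S p ≤ 1 ⇔ AtMostOne (λ u → ¬ T (spread G S u))
  rest≤1⇔ f p S ¬full with full G S
  ... | true = ⊥-elim (¬full _)
  ... | false with full G (spread G S) in full′
  ...   | true = mk⇔ (const λ x _ ¬x → ⊥-elim (¬x (to T-full (from T-≡ full′) x))) (const ≤-refl)
  ...   | false = ⇔.trans (mk⇔ ≤-pred s≤s) (lastSelection≤0⇔ f p (spread G S) (subst T full′))

  burnOnly : Fin n → Burned G
  burnOnly v = burn G v (noneBurned G)

  T-spread-burnOnly⇔ : ∀ {v u} → T (spread G (burnOnly v) u) ⇔ (v ≡ u ⊎ T (adj G v u))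
  T-spread-burnOnly⇔ {v} {u} = mk⇔
    ([ inj₁ ∘ onlyV
     , (λ (w , b , a) → inj₂ (subst (λ x → T (adj G x u)) (sym (onlyV b)) a)) ]′ ∘ to T-spread)
    [ from T-spread ∘ inj₁ ∘ from T-burn ∘ inj₁
    , (λ a → from T-spread (inj₂ (v , from (T-burn {v} {noneBurned G}) (inj₁ refl) , a))) ]′
    where
    onlyV : ∀ {w} → T (burnOnly v w) → v ≡ w
    onlyV b = [ id , (λ ()) ]′ (to T-burn b)

  ∸2≤degree⇔ : ∀ v →
    n ∸ 2 ≤ degree G v ⇔ AtMostOne (λ u → ¬ T (spread G (burnOnly v) u))
  ∸2≤degree⇔ v =
    ⇔.trans (subst (λ m → (m ∸ 2 ≤ degree G v) ⇔ (count outside ≤ 1)) n≡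
                   (m+1+n∸2≤m⇔n≤1 (degree G v) (count outside)))
    (⇔.trans count≤1⇔
      (mk⇔ (λ amo x y ¬x ¬y → amo x y (from T-not ¬x) (from T-not ¬y))
           (λ amo x y ox oy → amo x y (to T-not ox) (to T-not oy))))
    where
    outside : Fin n → Bool
    outside = not ∘ spread G (burnOnly v)

    outside≗ : ∀ u → u ≢ v → outside u ≡ not (adj G v u)
    outside≗ u u≢v = cong not (T-injective (mk⇔
      (λ t → [ (λ v≡u → ⊥-elim (u≢v (sym v≡u))) , id ]′ (to T-spread-burnOnly⇔ t))
      (from T-spread-burnOnly⇔ ∘ inj₂)))

    count-not-adj : count (not ∘ adj G v) ≡ suc (count outside)
    count-not-adj = count-remove v (cong not (irrefl G v))
      (cong not (to T-≡ (from (T-spread-burnOnly⇔ {v} {v}) (inj₁ refl)))) outside≗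

    -- The vertices split into the neighbours of v, v itself, and those outside N[v].
    n≡ : degree G v + suc (count outside) ≡ n
    n≡ = begin
      degree G v + suc (count outside)        ≡⟨ cong (_+ suc (count outside)) degree≡count ⟩
      count (adj G v) + suc (count outside)   ≡⟨ cong (count (adj G v) +_) count-not-adj ⟨
      count (adj G v) + count (not ∘ adj G v) ≡⟨ count-+-count-not (adj G v) ⟩
      n                                       ∎
      where
      open ≡-Reasoning
      degree≡count : degree G v ≡ count (adj G v)
      degree≡count = sum-indicator-tabulate (adj G v) id

≤maxDegree⇔ : ∀ {n} (G : Graph (suc n)) {k} → k ≤ maxDegree G ⇔ (∃[ v ] k ≤ degree G v)
≤maxDegree⇔ G = mk⇔
  ([ (λ k≤0 → zero , ≤-trans k≤0 z≤n) , to (Any-map-allFin⇔ _) ]′ ∘ to (≤-foldr-⊔⇔ 0 _))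
  (from (≤-foldr-⊔⇔ 0 _) ∘ inj₂ ∘ from (Any-map-allFin⇔ _))

≤minDegree⇔ : ∀ {n} (G : Graph n) {k} → k ≤ n → k ≤ minDegree G ⇔ (∀ v → k ≤ degree G v)
≤minDegree⇔ G k≤n = mk⇔
  (to (All-map-allFin⇔ _) ∘ proj₂ ∘ to (≤-foldr-⊓⇔ _ _))
  (λ h → from (≤-foldr-⊓⇔ _ _) (k≤n , from (All-map-allFin⇔ _) h))

module _ {k : ℕ} (G : Graph (suc (suc k))) where

  another : Fin (suc (suc k)) → Fin (suc (suc k))
  another zero = suc zero
  another (suc _) = zero

  another≢ : ∀ v → another v ≢ v
  another≢ zero ()
  another≢ (suc _) ()

  burnOnly-notFull : ∀ v → ¬ T (full G (burnOnly G v))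
  burnOnly-notFull v t =
    [ another≢ v ∘ sym , (λ ()) ]′ (to (T-burn G) (to (T-full G {burnOnly G v}) t (another v)))

  roundsAfter : Player → Fin (suc (suc k)) → ℕ
  roundsAfter p v = rest G (suc (suc k)) (burnOnly G v) p

  roundsAfter≰0 : ∀ p v → ¬ roundsAfter p v ≤ 0
  roundsAfter≰0 p v = burnOnly-notFull v ∘ to (rest≤0⇔ G (suc k) p (burnOnly G v))

  roundsAfter≤1⇔ : ∀ p v → roundsAfter p v ≤ 1 ⇔ k ≤ degree G v
  roundsAfter≤1⇔ p v =
    ⇔.trans (rest≤1⇔ G k p (burnOnly G v) (burnOnly-notFull v)) (⇔.sym (∸2≤degree⇔ G v))

  firstMoveValues : Player → List ℕ
  firstMoveValues p = map (roundsAfter (other p)) (allFin _)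

  opt-firstMoveValues≰0 : ∀ p → ¬ opt p (firstMoveValues p) ≤ 0
  opt-firstMoveValues≰0 Burner h =
    [ (λ ()) , (λ (v , h) → roundsAfter≰0 Staller v h) ∘ to (Any-map-allFin⇔ _) ]′
      (to (opt-Burner-≤⇔ (firstMoveValues Burner)) h)
  opt-firstMoveValues≰0 Staller h =
    roundsAfter≰0 Burner zero
      (to (All-map-allFin⇔ _) (to (opt-Staller-≤⇔ (firstMoveValues Staller)) h) zero)

  gameLength≢1 : ∀ p → gameLength G p ≢ 1
  gameLength≢1 p = opt-firstMoveValues≰0 p ∘ ≤-reflexive ∘ suc-injective

  gameLength≡2⇔ : ∀ p → gameLength G p ≡ 2 ⇔ opt p (firstMoveValues p) ≤ 1
  gameLength≡2⇔ p = mk⇔ (≤-reflexive ∘ suc-injective)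
                        (λ h → cong suc (≤-antisym h (≰⇒> (opt-firstMoveValues≰0 p))))

  bg≡2⇔ : bg G ≡ 2 ⇔ k ≤ maxDegree G
  bg≡2⇔ = begin
    bg G ≡ 2                                    ≈⟨ gameLength≡2⇔ Burner ⟩
    opt Burner values ≤ 1                       ≈⟨ opt-Burner-≤⇔ values ⟩
    (values ≡ [] ⊎ Any (_≤ 1) values)           ≈⟨ mk⇔ [ (λ ()) , id ]′ inj₂ ⟩
    Any (_≤ 1) values                           ≈⟨ Any-map-allFin⇔ _ ⟩
    (∃[ v ] roundsAfter Staller v ≤ 1)          ≈⟨ mk⇔ (Product.map₂ (to (roundsAfter≤1⇔ Staller _)))
                                                       (Product.map₂ (from (roundsAfter≤1⇔ Staller _))) ⟩
    (∃[ v ] k ≤ degree G v)                     ≈⟨ ≤maxDegree⇔ G ⟨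
    k ≤ maxDegree G                             ∎
    where
    open ⇔-Reasoning
    values : List ℕ
    values = firstMoveValues Burner

  bg′≡2⇔ : bg' G ≡ 2 ⇔ k ≤ minDegree G
  bg′≡2⇔ = begin
    bg' G ≡ 2                                   ≈⟨ gameLength≡2⇔ Staller ⟩
    opt Staller values ≤ 1                      ≈⟨ opt-Staller-≤⇔ values ⟩
    All (_≤ 1) values                           ≈⟨ All-map-allFin⇔ _ ⟩
    (∀ v → roundsAfter Burner v ≤ 1)            ≈⟨ mk⇔ (λ h v → to (roundsAfter≤1⇔ Burner v) (h v))
                                                       (λ h v → from (roundsAfter≤1⇔ Burner v) (h v)) ⟩
    (∀ v → k ≤ degree G v)                      ≈⟨ ≤minDegree⇔ G (m≤n+m k 2) ⟨
    k ≤ minDegree G                             ∎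
    where
    open ⇔-Reasoning
    values : List ℕ
    values = firstMoveValues Staller

-- Connectedness is only needed to rule out the empty graph.
proposition2p9 : ∀ {n : ℕ} (G : Graph n) → Connected G →
    ((bg G ≡ 1) ⇔ (n ≡ 1))
    × ((bg' G ≡ 1) ⇔ (n ≡ 1))
    × ((bg G ≡ 2) ⇔ ((n ≢ 1) × (n ∸ 2 ≤ maxDegree G)))
    × ((bg' G ≡ 2) ⇔ ((n ≢ 1) × (n ∸ 2 ≤ minDegree G)))
proposition2p9 {zero} G (() , _)
proposition2p9 {suc zero} G _ =
  mk⇔ (const refl) (const refl) ,
  mk⇔ (const refl) (const refl) ,
  mk⇔ (λ ()) (λ (1≢1 , _) → ⊥-elim (1≢1 refl)) ,
  mk⇔ (λ ()) (λ (1≢1 , _) → ⊥-elim (1≢1 refl))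
proposition2p9 {suc (suc k)} G _ =
  mk⇔ (⊥-elim ∘ gameLength≢1 G Burner) (λ ()) ,
  mk⇔ (⊥-elim ∘ gameLength≢1 G Staller) (λ ()) ,
  ⇔.trans (bg≡2⇔ G) (mk⇔ ((λ ()) ,_) proj₂) ,
  ⇔.trans (bg′≡2⇔ G) (mk⇔ ((λ ()) ,_) proj₂)
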